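{- Let $G$ be a finite graph on $n$ vertices and let $k=\max\{\alpha(G),\omega(G)\}$. Then $Z_f(G)\ge n/k$. Moreover, equality $Z_f(G)=n/k$ holds whenever $G$ is vertex-transitive.
   Context: $\alpha(G)$ is the maximum size of an independent set of $G$ and $\omega(G)$ the maximum size of a clique. A fractional cocoloring of $G$ is an assignment of nonnegative real weights to the cliques and independent sets of $G$ such that for every vertex $v$ the total weight of the cliques and independent sets containing $v$ is at least $1$; its weight is the sum of all assigned weights. The fractional cochromatic number $Z_f(G)$ is the minimum weight of a fractional cocoloring of $G$.
   Formalization: The weights of a fractional cocoloring are nonnegative rationals rather than nonnegative reals, so $Z_f(G)$ is the minimum weight over rational cocolorings. -}

module Defs where

open import Data.Nat using (ℕ; _⊔_)
open import Data.Integer using (+_)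
open import Data.Fin using (Fin)
open import Data.Fin.Subset using (Subset; _∈_; ∣_∣)
open import Data.Fin.Subset.Properties using (_∈?_)
open import Data.Fin.Permutation using (Permutation′; _⟨$⟩ʳ_)
open import Data.Rational using (ℚ; _+_; _*_; _≤_; 0ℚ; 1ℚ; _/_)
open import Data.List using (List; []; _∷_)
open import Data.Product using (Σ; ∃; _×_)
open import Data.Sum using (_⊎_)
open import Relation.Nullary using (¬_; yes; no)
open import Relation.Binary.PropositionalEquality using (_≡_; _≢_)

record Graph (n : ℕ) : Set₁ where
  field
    Adj     : Fin n → Fin n → Set
    symm    : ∀ {u v} → Adj u v → Adj v u
    irrefl  : ∀ {u} → ¬ Adj u u
open Graph public

module _ {n : ℕ} (G : Graph n) where

  IsClique : Subset n → Set
  IsClique S = ∀ u v → u ∈ S → v ∈ S → u ≢ v → Adj G u v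

  IsIndependent : Subset n → Set
  IsIndependent S = ∀ u v → u ∈ S → v ∈ S → ¬ Adj G u v

  IsIndependenceNumber : ℕ → Set
  IsIndependenceNumber a =
    (Σ (Subset n) λ S → IsIndependent S × ∣ S ∣ ≡ a) ×
    (∀ S → IsIndependent S → Data.Nat._≤_ ∣ S ∣ a)

  IsCliqueNumber : ℕ → Set
  IsCliqueNumber c =
    (Σ (Subset n) λ S → IsClique S × ∣ S ∣ ≡ c) ×
    (∀ S → IsClique S → Data.Nat._≤_ ∣ S ∣ c)

  record Entry : Set where
    field
      set        : Subset n
      weight     : ℚ
      nonneg     : 0ℚ ≤ weight
      cliqueOrIndep : IsClique set ⊎ IsIndependent set
  open Entry public

  coverage : Fin n → List Entry → ℚ
  coverage v [] = 0ℚ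
  coverage v (e ∷ es) with v ∈? set e
  ... | yes _ = weight e + coverage v es
  ... | no  _ = coverage v es

  totalWeight : List Entry → ℚ
  totalWeight [] = 0ℚ
  totalWeight (e ∷ es) = weight e + totalWeight es

  IsFractionalCocoloring : List Entry → Set
  IsFractionalCocoloring es = ∀ v → 1ℚ ≤ coverage v es

  IsFracCochromaticNumber : ℚ → Set
  IsFracCochromaticNumber z =
    (Σ (List Entry) λ es → IsFractionalCocoloring es × totalWeight es ≡ z) ×
    (∀ es → IsFractionalCocoloring es → z ≤ totalWeight es)

  IsAutomorphism : Permutation′ n → Set
  IsAutomorphism π = ∀ u v → (Adj G u v → Adj G (π ⟨$⟩ʳ u) (π ⟨$⟩ʳ v))
                           × (Adj G (π ⟨$⟩ʳ u) (π ⟨$⟩ʳ v) → Adj G u v)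

  VertexTransitive : Set
  VertexTransitive = ∀ u v → Σ (Permutation′ n) λ π → IsAutomorphism π × π ⟨$⟩ʳ u ≡ v

ℕtoℚ : ℕ → ℚ
ℕtoℚ m = (+ m) / 1

module Submission where

-- Lower bound: a clique or independent set has at most k vertices, so an entry
-- of weight w contributes at most k·w to the total coverage Σ_v coverage(v);
-- since every vertex is covered at least once, n ≤ k · (total weight).
--
-- Equality: let S be a largest clique or independent set (|S| = k) and let 𝓕 be
-- the orbit of S under the automorphisms (the closure of {S} under them).  By
-- transitivity every vertex lies in the same number c of members of 𝓕, and
-- counting incidences gives n·c = k·|𝓕|.  Weight 1/c on every member covers each
-- vertex exactly once, with total weight |𝓕|/c = n/k, which is optimal by the
-- lower bound.

open import Defs
open import Data.Nat using (ℕ; _⊔_)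
open import Data.Rational using (ℚ; _*_; _≤_)
open import Data.List using (List)
open import Data.Product using (Σ; _×_)
open import Relation.Binary.PropositionalEquality using (_≡_)

open import Algebra.Bundles using (Ring)
import Algebra.Properties.Semiring.Sum as SemiringSum
open import Data.Bool using (Bool; true; false; _∧_)
open import Data.Fin using (Fin; zero; suc; funToFin; finToFun; combine; remQuot)
import Data.Fin.Properties as Fin
open import Data.Fin.Permutation using (Permutation′; _⟨$⟩ʳ_; _⟨$⟩ˡ_; inverseˡ; inverseʳ; flip; permutation)
open import Data.Fin.Subset using (Subset; ∣_∣; _∈_; _∉_; _⊆_; _⊃_; _∩_; _∪_; ⁅_⁆)
open import Data.Fin.Subset.Induction using (Acc; acc; ⊃-wellFounded)
import Data.Fin.Subset.Properties as Subset
import Data.Integer as ℤ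
import Data.Integer.Properties as ℤ
open import Data.List using ([]; _∷_)
open import Data.Nat as ℕ using (zero; suc)
import Data.Nat.Properties as ℕ
open import Data.Product using (_,_; proj₁; proj₂; uncurry)
open import Data.Rational as ℚ using (0ℚ; 1ℚ; _+_)
import Data.Rational.Properties as ℚ
import Data.Rational.Unnormalised as ℚᵘ
import Data.Rational.Unnormalised.Properties as ℚᵘ
open import Data.Sum using (_⊎_; inj₁; inj₂)
open import Data.Vec using (_∷_; []; lookup; tabulate; here; there)
import Data.Vec.Properties as Vec
open import Function using (_∘_)
open import Relation.Binary.PropositionalEquality using (refl; sym; trans; cong; cong₂; subst; subst₂; module ≡-Reasoning)
open import Relation.Nullary using (yes; no; contradiction)

module ∑ℕ = SemiringSum ℕ.+-*-semiring
module ∑ℚ = SemiringSum (Ring.semiring ℚ.+-*-ring)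

ℕtoℚ-suc : ∀ m → ℕtoℚ (suc m) ≡ 1ℚ + ℕtoℚ m
ℕtoℚ-suc m = ℚ.toℚᵘ-injective (begin
    ℚ.toℚᵘ (ℕtoℚ (suc m))                   ≈⟨ ℚ.toℚᵘ-fromℚᵘ (ℚᵘ.mkℚᵘ (ℤ.+ suc m) 0) ⟩
    ℚᵘ.mkℚᵘ (ℤ.+ suc m) 0                   ≈⟨ ℚᵘ.*≡* integral ⟩
    ℚ.toℚᵘ 1ℚ ℚᵘ.+ ℚᵘ.mkℚᵘ (ℤ.+ m) 0        ≈⟨ ℚᵘ.+-congʳ (ℚ.toℚᵘ 1ℚ) (ℚᵘ.≃-sym (ℚ.toℚᵘ-fromℚᵘ (ℚᵘ.mkℚᵘ (ℤ.+ m) 0))) ⟩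
    ℚ.toℚᵘ 1ℚ ℚᵘ.+ ℚ.toℚᵘ (ℕtoℚ m)          ≈⟨ ℚᵘ.≃-sym (ℚ.toℚᵘ-homo-+ 1ℚ (ℕtoℚ m)) ⟩
    ℚ.toℚᵘ (1ℚ + ℕtoℚ m)                    ∎)
  where
  open import Relation.Binary.Reasoning.Setoid ℚᵘ.≃-setoid
  -- both sides have denominator 1, so this is 1 + m = 1 + m over ℤ
  integral : ℤ.+ suc m ℤ.* ℤ.+ 1 ≡ (ℤ.+ 1 ℤ.+ ℤ.+ m ℤ.* ℤ.+ 1) ℤ.* ℤ.+ 1
  integral = cong (ℤ._* ℤ.+ 1) (cong (ℤ._+_ (ℤ.+ 1)) (sym (ℤ.*-identityʳ (ℤ.+ m))))

ℕtoℚ-+ : ∀ m n → ℕtoℚ (m ℕ.+ n) ≡ ℕtoℚ m + ℕtoℚ n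
ℕtoℚ-+ zero    n = sym (ℚ.+-identityˡ (ℕtoℚ n))
ℕtoℚ-+ (suc m) n = begin
  ℕtoℚ (suc (m ℕ.+ n))          ≡⟨ ℕtoℚ-suc (m ℕ.+ n) ⟩
  1ℚ + ℕtoℚ (m ℕ.+ n)           ≡⟨ cong (1ℚ +_) (ℕtoℚ-+ m n) ⟩
  1ℚ + (ℕtoℚ m + ℕtoℚ n)        ≡⟨ ℚ.+-assoc 1ℚ (ℕtoℚ m) (ℕtoℚ n) ⟨
  (1ℚ + ℕtoℚ m) + ℕtoℚ n        ≡⟨ cong (_+ ℕtoℚ n) (ℕtoℚ-suc m) ⟨
  ℕtoℚ (suc m) + ℕtoℚ n         ∎
  where open ≡-Reasoning

ℕtoℚ-* : ∀ m n → ℕtoℚ (m ℕ.* n) ≡ ℕtoℚ m * ℕtoℚ n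
ℕtoℚ-* zero    n = sym (ℚ.*-zeroˡ (ℕtoℚ n))
ℕtoℚ-* (suc m) n = begin
  ℕtoℚ (n ℕ.+ m ℕ.* n)             ≡⟨ ℕtoℚ-+ n (m ℕ.* n) ⟩
  ℕtoℚ n + ℕtoℚ (m ℕ.* n)          ≡⟨ cong₂ _+_ (sym (ℚ.*-identityˡ (ℕtoℚ n))) (ℕtoℚ-* m n) ⟩
  1ℚ * ℕtoℚ n + ℕtoℚ m * ℕtoℚ n    ≡⟨ ℚ.*-distribʳ-+ (ℕtoℚ n) 1ℚ (ℕtoℚ m) ⟨
  (1ℚ + ℕtoℚ m) * ℕtoℚ n           ≡⟨ cong (_* ℕtoℚ n) (ℕtoℚ-suc m) ⟨
  ℕtoℚ (suc m) * ℕtoℚ n            ∎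
  where open ≡-Reasoning

ℕtoℚ-nonNeg : ∀ m → 0ℚ ≤ ℕtoℚ m
ℕtoℚ-nonNeg m = ℚ.nonNegative⁻¹ (ℕtoℚ m) {{ℚ.normalize-nonNeg m 1}}

ℕtoℚ-pos : ∀ m → ℚ.Positive (ℕtoℚ (suc m))
ℕtoℚ-pos m = ℚ.normalize-pos (suc m) 1

ℕtoℚ-mono : ∀ {m n} → m ℕ.≤ n → ℕtoℚ m ≤ ℕtoℚ n
ℕtoℚ-mono {m} {n} m≤n = begin
  ℕtoℚ m                        ≡⟨ ℚ.+-identityʳ (ℕtoℚ m) ⟨
  ℕtoℚ m + 0ℚ                   ≤⟨ ℚ.+-monoʳ-≤ (ℕtoℚ m) (ℕtoℚ-nonNeg (n ℕ.∸ m)) ⟩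
  ℕtoℚ m + ℕtoℚ (n ℕ.∸ m)       ≡⟨ ℕtoℚ-+ m (n ℕ.∸ m) ⟨
  ℕtoℚ (m ℕ.+ (n ℕ.∸ m))        ≡⟨ cong ℕtoℚ (ℕ.m+[n∸m]≡n m≤n) ⟩
  ℕtoℚ n                        ∎
  where open ℚ.≤-Reasoning

scale-+ : ∀ w a b → w * ℕtoℚ a + w * ℕtoℚ b ≡ w * ℕtoℚ (a ℕ.+ b)
scale-+ w a b = trans (sym (ℚ.*-distribˡ-+ w (ℕtoℚ a) (ℕtoℚ b))) (cong (w *_) (sym (ℕtoℚ-+ a b)))

bit : Bool → ℕ
bit true  = 1
bit false = 0

∑ℕ-const : ∀ n c → ∑ℕ.sum {n} (λ _ → c) ≡ n ℕ.* c
∑ℕ-const zero    c = refl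
∑ℕ-const (suc n) c = cong (c ℕ.+_) (∑ℕ-const n c)

∑ℚ-one : ∀ n → ∑ℚ.sum {n} (λ _ → 1ℚ) ≡ ℕtoℚ n
∑ℚ-one zero    = refl
∑ℚ-one (suc n) = trans (cong (1ℚ +_) (∑ℚ-one n)) (sym (ℕtoℚ-suc n))

∑ℚ-mono-≤ : ∀ {n} (f g : Fin n → ℚ) → (∀ i → f i ≤ g i) → ∑ℚ.sum f ≤ ∑ℚ.sum g
∑ℚ-mono-≤ {zero}  f g f≤g = ℚ.≤-refl
∑ℚ-mono-≤ {suc n} f g f≤g = ℚ.+-mono-≤ (f≤g zero) (∑ℚ-mono-≤ (f ∘ suc) (g ∘ suc) (f≤g ∘ suc))

∑-scale : ∀ {n} w (f : Fin n → ℕ) → ∑ℚ.sum (λ i → w * ℕtoℚ (f i)) ≡ w * ℕtoℚ (∑ℕ.sum f)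
∑-scale {zero}  w f = sym (ℚ.*-zeroʳ w)
∑-scale {suc n} w f = trans (cong (w * ℕtoℚ (f zero) +_) (∑-scale w (f ∘ suc)))
                            (scale-+ w (f zero) (∑ℕ.sum (f ∘ suc)))

∣∷∣ : ∀ {n} b (p : Subset n) → ∣ b ∷ p ∣ ≡ bit b ℕ.+ ∣ p ∣
∣∷∣ true  p = refl
∣∷∣ false p = refl

∣∣≡∑ : ∀ {n} (p : Subset n) → ∣ p ∣ ≡ ∑ℕ.sum (λ x → bit (lookup p x))
∣∣≡∑ []      = refl
∣∣≡∑ (b ∷ p) = trans (∣∷∣ b p) (cong (bit b ℕ.+_) (∣∣≡∑ p))

∈⇒1≤∣∣ : ∀ {n} {x : Fin n} {p : Subset n} → x ∈ p → 1 ℕ.≤ ∣ p ∣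
∈⇒1≤∣∣ {x = x} x∈p = subst (ℕ._≤ _) (Subset.∣⁅x⁆∣≡1 x)
  (Subset.p⊆q⇒∣p∣≤∣q∣ (λ y∈⁅x⁆ → subst (_∈ _) (sym (Subset.x∈⁅y⁆⇒x≡y x y∈⁅x⁆)) x∈p))

∈-tabulate⁺ : ∀ {n} {f : Fin n → Bool} {x} → f x ≡ true → x ∈ tabulate f
∈-tabulate⁺ {f = f} {x} fx = Vec.lookup⇒[]= x (tabulate f) (trans (Vec.lookup∘tabulate f x) fx)

∈-tabulate⁻ : ∀ {n} {f : Fin n → Bool} {x} → x ∈ tabulate f → f x ≡ true
∈-tabulate⁻ {f = f} {x} x∈ = trans (sym (Vec.lookup∘tabulate f x)) (Vec.[]=⇒lookup x∈)

∉⇒lookup-false : ∀ {n} {p : Subset n} {x} → x ∉ p → lookup p x ≡ false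
∉⇒lookup-false {p = p} {x} x∉p with lookup p x in eq
... | true  = contradiction (Vec.lookup⇒[]= x p eq) x∉p
... | false = refl

img : ∀ {N} → Permutation′ N → Subset N → Subset N
img σ p = tabulate (λ y → lookup p (σ ⟨$⟩ˡ y))

∈-img⁺ : ∀ {N} (σ : Permutation′ N) {p x} → x ∈ p → σ ⟨$⟩ʳ x ∈ img σ p
∈-img⁺ σ {p} x∈p = ∈-tabulate⁺ (trans (cong (lookup p) (inverseˡ σ)) (Vec.[]=⇒lookup x∈p))

∈-img⁻ : ∀ {N} (σ : Permutation′ N) {p y} → y ∈ img σ p → σ ⟨$⟩ˡ y ∈ p
∈-img⁻ σ {p} {y} y∈ = Vec.lookup⇒[]= (σ ⟨$⟩ˡ y) p (∈-tabulate⁻ y∈)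

img-flip : ∀ {N} (σ : Permutation′ N) p → img σ (img (flip σ) p) ≡ p
img-flip σ p = begin
  tabulate (λ y → lookup (tabulate (λ x → lookup p (σ ⟨$⟩ʳ x))) (σ ⟨$⟩ˡ y))
    ≡⟨ Vec.tabulate-cong (λ y → Vec.lookup∘tabulate (λ x → lookup p (σ ⟨$⟩ʳ x)) (σ ⟨$⟩ˡ y)) ⟩
  tabulate (λ y → lookup p (σ ⟨$⟩ʳ (σ ⟨$⟩ˡ y)))
    ≡⟨ Vec.tabulate-cong (λ y → cong (lookup p) (inverseʳ σ)) ⟩
  tabulate (lookup p)
    ≡⟨ Vec.tabulate∘lookup p ⟩
  p ∎
  where open ≡-Reasoning

∣img∣ : ∀ {N} (σ : Permutation′ N) p → ∣ img σ p ∣ ≡ ∣ p ∣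
∣img∣ σ p = begin
  ∣ img σ p ∣                                         ≡⟨ ∣∣≡∑ (img σ p) ⟩
  ∑ℕ.sum (λ y → bit (lookup (img σ p) y))             ≡⟨ ∑ℕ.sum-permute (λ y → bit (lookup (img σ p) y)) σ ⟩
  ∑ℕ.sum (λ x → bit (lookup (img σ p) (σ ⟨$⟩ʳ x)))    ≡⟨ ∑ℕ.sum-cong-≗ (λ x → cong bit (lookup-img x)) ⟩
  ∑ℕ.sum (λ x → bit (lookup p x))                     ≡⟨ ∣∣≡∑ p ⟨
  ∣ p ∣                                               ∎
  where
  open ≡-Reasoning
  lookup-img : ∀ x → lookup (img σ p) (σ ⟨$⟩ʳ x) ≡ lookup p x
  lookup-img x = trans (Vec.lookup∘tabulate _ (σ ⟨$⟩ʳ x)) (cong (lookup p) (inverseˡ σ))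

-- Coding the subsets of Fin n by the elements of Fin (2 ^ n), via the
-- library bijection between Fin (2 ^ n) and functions Fin n → Fin 2.

toFin₂ : Bool → Fin 2
toFin₂ false = zero
toFin₂ true  = suc zero

toBool : Fin 2 → Bool
toBool zero       = false
toBool (suc zero) = true

toBool-toFin₂ : ∀ b → toBool (toFin₂ b) ≡ b
toBool-toFin₂ false = refl
toBool-toFin₂ true  = refl

toFin₂-toBool : ∀ i → toFin₂ (toBool i) ≡ i
toFin₂-toBool zero       = refl
toFin₂-toBool (suc zero) = refl

-- funToFin respects pointwise equality (the library states its inverse laws pointwise).
funToFin-cong : ∀ {m n} {f g : Fin m → Fin n} → (∀ x → f x ≡ g x) → funToFin f ≡ funToFin g
funToFin-cong {zero}  f≗g = refl
funToFin-cong {suc m} f≗g = cong₂ combine (f≗g zero) (funToFin-cong (f≗g ∘ suc))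

encode : ∀ {n} → Subset n → Fin (2 ℕ.^ n)
encode p = funToFin (toFin₂ ∘ lookup p)

decode : ∀ {n} → Fin (2 ℕ.^ n) → Subset n
decode i = tabulate (toBool ∘ finToFun i)

decode-encode : ∀ {n} (p : Subset n) → decode (encode p) ≡ p
decode-encode p = trans
  (Vec.tabulate-cong (λ x → trans (cong toBool (Fin.finToFun-funToFin (toFin₂ ∘ lookup p) x))
                                  (toBool-toFin₂ (lookup p x))))
  (Vec.tabulate∘lookup p)

encode-decode : ∀ {n} (i : Fin (2 ℕ.^ n)) → encode (decode {n} i) ≡ i
encode-decode {n} i = trans
  (funToFin-cong {n} (λ x → trans (cong toFin₂ (Vec.lookup∘tabulate (toBool ∘ finToFun {2} {n} i) x))
                                  (toFin₂-toBool (finToFun {2} {n} i x))))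
  (Fin.funToFin-finToFin {n} i)

lift : ∀ {n} → Permutation′ n → Permutation′ (2 ℕ.^ n)
lift {n} g = permutation (act g) (act (flip g)) (inverse g) (inverse (flip g))
  where
  act : Permutation′ n → Fin (2 ℕ.^ n) → Fin (2 ℕ.^ n)
  act h i = encode (img h (decode {n} i))
  inverse : ∀ h i → act h (act (flip h) i) ≡ i
  inverse h i = begin
    encode (img h (decode (encode (img (flip h) (decode {n} i)))))
      ≡⟨ cong (encode ∘ img h) (decode-encode (img (flip h) (decode {n} i))) ⟩
    encode (img h (img (flip h) (decode {n} i)))
      ≡⟨ cong encode (img-flip h (decode {n} i)) ⟩
    encode (decode {n} i)
      ≡⟨ encode-decode {n} i ⟩
    i ∎
    where open ≡-Reasoning

decode-lift : ∀ {n} (g : Permutation′ n) i → decode (lift g ⟨$⟩ʳ i) ≡ img g (decode {n} i)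
decode-lift {n} g i = decode-encode (img g (decode {n} i))

grow : ∀ {m N} → (Fin m → Permutation′ N) → Subset N → Subset N
grow {zero}  σ p = p
grow {suc m} σ p = img (σ zero) p ∪ grow (σ ∘ suc) p

⊆-grow : ∀ {m N} (σ : Fin m → Permutation′ N) {p} → p ⊆ grow σ p
⊆-grow {zero}  σ     x∈p = x∈p
⊆-grow {suc m} σ {p} x∈p = Subset.q⊆p∪q (img (σ zero) p) (grow (σ ∘ suc) p) (⊆-grow (σ ∘ suc) x∈p)

img⊆grow : ∀ {m N} (σ : Fin m → Permutation′ N) {p} j → img (σ j) p ⊆ grow σ p
img⊆grow {suc m} σ     zero    x∈ = Subset.p⊆p∪q _ x∈
img⊆grow {suc m} σ {p} (suc j) x∈ = Subset.q⊆p∪q (img (σ zero) p) _ (img⊆grow (σ ∘ suc) j x∈)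

grow-preserves : ∀ {m N} (σ : Fin m → Permutation′ N) (P : Fin N → Set) →
  (∀ j {x} → P x → P (σ j ⟨$⟩ʳ x)) →
  ∀ {p} → (∀ {x} → x ∈ p → P x) → ∀ {y} → y ∈ grow σ p → P y
grow-preserves {zero}  σ P pres Pp y∈ = Pp y∈
grow-preserves {suc m} σ P pres {p} Pp y∈ with Subset.x∈p∪q⁻ (img (σ zero) p) (grow (σ ∘ suc) p) y∈
... | inj₁ y∈img  = subst P (inverseʳ (σ zero)) (pres zero (Pp (∈-img⁻ (σ zero) y∈img)))
... | inj₂ y∈grow = grow-preserves (σ ∘ suc) P (λ j → pres (suc j)) Pp y∈grow

record Closure {m N} (σ : Fin m → Permutation′ N) (P : Fin N → Set) (p : Subset N) : Set where
  field
    carrier  : Subset N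
    extends  : p ⊆ carrier
    respects : ∀ {x} → x ∈ carrier → P x
    closed   : ∀ j → img (σ j) carrier ⊆ carrier

-- Closures exist: iterate grow until it stabilises, which happens because
-- strictly increasing chains of subsets of Fin N are finite.
closure : ∀ {m N} (σ : Fin m → Permutation′ N) (P : Fin N → Set) →
  (∀ j {x} → P x → P (σ j ⟨$⟩ʳ x)) →
  ∀ p → (∀ {x} → x ∈ p → P x) → Closure σ P p
closure σ P pres p = iterate p (⊃-wellFounded p)
  where
  iterate : ∀ p → Acc _⊃_ p → (∀ {x} → x ∈ p → P x) → Closure σ P p
  iterate p (acc larger) Pp with p Subset.⊂? grow σ p
  ... | yes p⊂grow = record
    { carrier  = Closure.carrier rest
    ; extends  = Closure.extends rest ∘ ⊆-grow σ
    ; respects = Closure.respects rest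
    ; closed   = Closure.closed rest
    }
    where rest = iterate (grow σ p) (larger p⊂grow) (grow-preserves σ P pres Pp)
  ... | no p⊄grow = record
    { carrier  = p
    ; extends  = λ x∈p → x∈p
    ; respects = Pp
    ; closed   = λ j → stable ∘ img⊆grow σ j
    }
    where
    stable : grow σ p ⊆ p
    stable {x} x∈grow with x Subset.∈? p
    ... | yes x∈p = x∈p
    ... | no  x∉p = contradiction ((λ {y} → ⊆-grow σ {p} {y}) , x , x∈grow , x∉p) p⊄grow

module _ {n} (G : Graph n) where

  IsHomogeneous : Subset n → Set
  IsHomogeneous T = IsClique G T ⊎ IsIndependent G T

  IsHomogeneousOfSize : ℕ → Subset n → Set
  IsHomogeneousOfSize k T = IsHomogeneous T × ∣ T ∣ ≡ k

  AllHomogeneous : ∀ {N} → (Fin N → Subset n) → Subset N → Set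
  AllHomogeneous d 𝓕 = ∀ {i} → i ∈ 𝓕 → IsHomogeneous (d i)

  module _ (g : Permutation′ n) (auto : IsAutomorphism G g) where

    adj-pull : ∀ {u v} → Adj G u v → Adj G (g ⟨$⟩ˡ u) (g ⟨$⟩ˡ v)
    adj-pull adj = proj₂ (auto _ _) (subst₂ (Adj G) (sym (inverseʳ g)) (sym (inverseʳ g)) adj)

    adj-push : ∀ {u v} → Adj G (g ⟨$⟩ˡ u) (g ⟨$⟩ˡ v) → Adj G u v
    adj-push adj = subst₂ (Adj G) (inverseʳ g) (inverseʳ g) (proj₁ (auto _ _) adj)

    clique-img : ∀ {T} → IsClique G T → IsClique G (img g T)
    clique-img clique u v u∈ v∈ u≢v = adj-push (clique _ _ (∈-img⁻ g u∈) (∈-img⁻ g v∈)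
      (λ eq → u≢v (trans (sym (inverseʳ g)) (trans (cong (g ⟨$⟩ʳ_) eq) (inverseʳ g)))))

    independent-img : ∀ {T} → IsIndependent G T → IsIndependent G (img g T)
    independent-img independent u v u∈ v∈ adj = independent _ _ (∈-img⁻ g u∈) (∈-img⁻ g v∈) (adj-pull adj)

    homogeneous-img : ∀ {k T} → IsHomogeneousOfSize k T → IsHomogeneousOfSize k (img g T)
    homogeneous-img {T = T} (inj₁ clique      , size) = inj₁ (clique-img clique) , trans (∣img∣ g T) size
    homogeneous-img {T = T} (inj₂ independent , size) = inj₂ (independent-img independent) , trans (∣img∣ g T) size

module _ {n} (G : Graph n) where

  share : Entry G → Fin n → ℚ
  share e v = weight e * ℕtoℚ (bit (lookup (set e) v))

  coverage-∷ : ∀ v e es → coverage G v (e ∷ es) ≡ share e v + coverage G v es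
  coverage-∷ v e es with v Subset.∈? set e
  ... | yes v∈ rewrite Vec.[]=⇒lookup v∈ = cong (_+ coverage G v es) (sym (ℚ.*-identityʳ (weight e)))
  ... | no  v∉ rewrite ∉⇒lookup-false v∉ = begin
    coverage G v es               ≡⟨ ℚ.+-identityˡ (coverage G v es) ⟨
    0ℚ + coverage G v es          ≡⟨ cong (_+ coverage G v es) (ℚ.*-zeroʳ (weight e)) ⟨
    weight e * 0ℚ + coverage G v es ∎
    where open ≡-Reasoning

  ∑-share : ∀ e → ∑ℚ.sum (share e) ≡ weight e * ℕtoℚ ∣ set e ∣
  ∑-share e = trans (∑-scale (weight e) (bit ∘ lookup (set e))) (cong (λ s → weight e * ℕtoℚ s) (sym (∣∣≡∑ (set e))))

  ∑-coverage : ∀ k → (∀ e → ∣ set e ∣ ℕ.≤ k) →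
    ∀ es → ∑ℚ.sum (λ v → coverage G v es) ≤ ℕtoℚ k * totalWeight G es
  ∑-coverage k bounded [] = ℚ.≤-reflexive (trans (∑ℚ.sum-replicate-zero n) (sym (ℚ.*-zeroʳ (ℕtoℚ k))))
  ∑-coverage k bounded (e ∷ es) = begin
    ∑ℚ.sum (λ v → coverage G v (e ∷ es))
      ≡⟨ ∑ℚ.sum-cong-≗ (λ v → coverage-∷ v e es) ⟩
    ∑ℚ.sum (λ v → share e v + coverage G v es)
      ≡⟨ ∑ℚ.∑-distrib-+ (share e) (λ v → coverage G v es) ⟩
    ∑ℚ.sum (share e) + ∑ℚ.sum (λ v → coverage G v es)
      ≡⟨ cong (_+ ∑ℚ.sum (λ v → coverage G v es)) (∑-share e) ⟩
    weight e * ℕtoℚ ∣ set e ∣ + ∑ℚ.sum (λ v → coverage G v es)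
      ≤⟨ ℚ.+-mono-≤ (ℚ.*-monoˡ-≤-nonNeg (weight e) {{ℚ.nonNegative (nonneg e)}} (ℕtoℚ-mono (bounded e)))
                    (∑-coverage k bounded es) ⟩
    weight e * ℕtoℚ k + ℕtoℚ k * totalWeight G es
      ≡⟨ cong (_+ ℕtoℚ k * totalWeight G es) (ℚ.*-comm (weight e) (ℕtoℚ k)) ⟩
    ℕtoℚ k * weight e + ℕtoℚ k * totalWeight G es
      ≡⟨ ℚ.*-distribˡ-+ (ℕtoℚ k) (weight e) (totalWeight G es) ⟨
    ℕtoℚ k * totalWeight G (e ∷ es) ∎
    where open ℚ.≤-Reasoning

  lowerBound : ∀ k → (∀ e → ∣ set e ∣ ℕ.≤ k) →
    ∀ es → IsFractionalCocoloring G es → ℕtoℚ n ≤ ℕtoℚ k * totalWeight G es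
  lowerBound k bounded es covering = begin
    ℕtoℚ n                               ≡⟨ ∑ℚ-one n ⟨
    ∑ℚ.sum {n} (λ _ → 1ℚ)                ≤⟨ ∑ℚ-mono-≤ (λ _ → 1ℚ) (λ v → coverage G v es) covering ⟩
    ∑ℚ.sum (λ v → coverage G v es)       ≤⟨ ∑-coverage k bounded es ⟩
    ℕtoℚ k * totalWeight G es            ∎
    where open ℚ.≤-Reasoning

-- A family is a subset 𝓕 of an index set Fin N
-- together with a decoding d of indices into vertex sets; containing d v is
-- the set of indices whose vertex set contains v, so ∣ 𝓕 ∩ containing d v ∣
-- counts the members of the family that contain v.

containing : ∀ {n N} → (Fin N → Subset n) → Fin n → Subset N
containing d v = tabulate (λ i → lookup (d i) v)

∈-containing⁺ : ∀ {n N} {d : Fin N → Subset n} {v i} → v ∈ d i → i ∈ containing d v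
∈-containing⁺ v∈ = ∈-tabulate⁺ (Vec.[]=⇒lookup v∈)

∈-containing⁻ : ∀ {n N} {d : Fin N → Subset n} {v i} → i ∈ containing d v → v ∈ d i
∈-containing⁻ {d = d} {v} {i} i∈ = Vec.lookup⇒[]= v (d i) (∈-tabulate⁻ i∈)

∑-incidences : ∀ {n N} k (d : Fin N → Subset n) (𝓕 : Subset N) → (∀ {i} → i ∈ 𝓕 → ∣ d i ∣ ≡ k) →
  ∑ℕ.sum (λ v → ∣ 𝓕 ∩ containing d v ∣) ≡ k ℕ.* ∣ 𝓕 ∣
∑-incidences {n} k d [] sizes = trans (∑ℕ-const n 0) (trans (ℕ.*-zeroʳ n) (sym (ℕ.*-zeroʳ k)))
∑-incidences {n} k d (b ∷ 𝓕) sizes = begin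
  ∑ℕ.sum (λ v → ∣ (b ∧ lookup (d zero) v) ∷ (𝓕 ∩ containing (d ∘ suc) v) ∣)
    ≡⟨ ∑ℕ.sum-cong-≗ (λ v → ∣∷∣ (b ∧ lookup (d zero) v) (𝓕 ∩ containing (d ∘ suc) v)) ⟩
  ∑ℕ.sum (λ v → bit (b ∧ lookup (d zero) v) ℕ.+ ∣ 𝓕 ∩ containing (d ∘ suc) v ∣)
    ≡⟨ ∑ℕ.∑-distrib-+ (λ v → bit (b ∧ lookup (d zero) v)) (λ v → ∣ 𝓕 ∩ containing (d ∘ suc) v ∣) ⟩
  ∑ℕ.sum (λ v → bit (b ∧ lookup (d zero) v)) ℕ.+ ∑ℕ.sum (λ v → ∣ 𝓕 ∩ containing (d ∘ suc) v ∣)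
    ≡⟨ cong₂ ℕ._+_ (first b (λ b≡true → sizes (subst (λ b → zero ∈ b ∷ 𝓕) (sym b≡true) here)))
                   (∑-incidences k (d ∘ suc) 𝓕 (λ i∈ → sizes (there i∈))) ⟩
  k ℕ.* bit b ℕ.+ k ℕ.* ∣ 𝓕 ∣
    ≡⟨ ℕ.*-distribˡ-+ k (bit b) ∣ 𝓕 ∣ ⟨
  k ℕ.* (bit b ℕ.+ ∣ 𝓕 ∣)
    ≡⟨ cong (k ℕ.*_) (∣∷∣ b 𝓕) ⟨
  k ℕ.* ∣ b ∷ 𝓕 ∣ ∎
  where
  open ≡-Reasoning
  first : ∀ b → (b ≡ true → ∣ d zero ∣ ≡ k) → ∑ℕ.sum (λ v → bit (b ∧ lookup (d zero) v)) ≡ k ℕ.* bit b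
  first true  size = trans (sym (∣∣≡∑ (d zero))) (trans (size refl) (sym (ℕ.*-identityʳ k)))
  first false _    = trans (∑ℕ-const n 0) (trans (ℕ.*-zeroʳ n) (sym (ℕ.*-zeroʳ k)))

module _ {n} (G : Graph n) (w : ℚ) (0≤w : 0ℚ ≤ w) where

  familyEntries : ∀ {N} (d : Fin N → Subset n) (𝓕 : Subset N) → AllHomogeneous G d 𝓕 → List (Entry G)
  familyEntries d []          homogeneous = []
  familyEntries d (false ∷ 𝓕) homogeneous = familyEntries (d ∘ suc) 𝓕 (λ i∈ → homogeneous (there i∈))
  familyEntries d (true ∷ 𝓕)  homogeneous =
    record { set = d zero ; weight = w ; nonneg = 0≤w ; cliqueOrIndep = homogeneous here }
    ∷ familyEntries (d ∘ suc) 𝓕 (λ i∈ → homogeneous (there i∈))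

  coverage-family : ∀ {N} v (d : Fin N → Subset n) 𝓕 (homogeneous : AllHomogeneous G d 𝓕) →
    coverage G v (familyEntries d 𝓕 homogeneous) ≡ w * ℕtoℚ ∣ 𝓕 ∩ containing d v ∣
  coverage-family v d []          homogeneous = sym (ℚ.*-zeroʳ w)
  coverage-family v d (false ∷ 𝓕) homogeneous = coverage-family v (d ∘ suc) 𝓕 (λ i∈ → homogeneous (there i∈))
  coverage-family v d (true ∷ 𝓕)  homogeneous = begin
    coverage G v (e ∷ rest)                          ≡⟨ coverage-∷ G v e rest ⟩
    w * ℕtoℚ (bit (lookup (d zero) v)) + coverage G v rest
      ≡⟨ cong (w * ℕtoℚ (bit (lookup (d zero) v)) +_) (coverage-family v (d ∘ suc) 𝓕 (λ i∈ → homogeneous (there i∈))) ⟩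
    w * ℕtoℚ (bit (lookup (d zero) v)) + w * ℕtoℚ ∣ 𝓕 ∩ containing (d ∘ suc) v ∣
      ≡⟨ scale-+ w (bit (lookup (d zero) v)) ∣ 𝓕 ∩ containing (d ∘ suc) v ∣ ⟩
    w * ℕtoℚ (bit (lookup (d zero) v) ℕ.+ ∣ 𝓕 ∩ containing (d ∘ suc) v ∣)
      ≡⟨ cong (λ s → w * ℕtoℚ s) (∣∷∣ (lookup (d zero) v) (𝓕 ∩ containing (d ∘ suc) v)) ⟨
    w * ℕtoℚ ∣ lookup (d zero) v ∷ (𝓕 ∩ containing (d ∘ suc) v) ∣ ∎
    where
    open ≡-Reasoning
    e = record { set = d zero ; weight = w ; nonneg = 0≤w ; cliqueOrIndep = homogeneous here }
    rest = familyEntries (d ∘ suc) 𝓕 (λ i∈ → homogeneous (there i∈))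

  totalWeight-family : ∀ {N} (d : Fin N → Subset n) 𝓕 (homogeneous : AllHomogeneous G d 𝓕) →
    totalWeight G (familyEntries d 𝓕 homogeneous) ≡ w * ℕtoℚ ∣ 𝓕 ∣
  totalWeight-family d []          homogeneous = sym (ℚ.*-zeroʳ w)
  totalWeight-family d (false ∷ 𝓕) homogeneous = totalWeight-family (d ∘ suc) 𝓕 (λ i∈ → homogeneous (there i∈))
  totalWeight-family d (true ∷ 𝓕)  homogeneous = begin
    w + totalWeight G (familyEntries (d ∘ suc) 𝓕 (λ i∈ → homogeneous (there i∈)))  ≡⟨ cong₂ _+_ (sym (ℚ.*-identityʳ w)) (totalWeight-family (d ∘ suc) 𝓕 (λ i∈ → homogeneous (there i∈))) ⟩
    w * 1ℚ + w * ℕtoℚ ∣ 𝓕 ∣                          ≡⟨ scale-+ w 1 ∣ 𝓕 ∣ ⟩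
    w * ℕtoℚ (suc ∣ 𝓕 ∣)                              ∎
    where open ≡-Reasoning

1/suc : ℕ → ℚ
1/suc c = ℚ.1/_ (ℕtoℚ (suc c)) {{ℚ.pos⇒nonZero (ℕtoℚ (suc c)) {{ℕtoℚ-pos c}}}}

1/suc-inverse : ∀ c → 1/suc c * ℕtoℚ (suc c) ≡ 1ℚ
1/suc-inverse c = ℚ.*-inverseˡ (ℕtoℚ (suc c)) {{ℚ.pos⇒nonZero (ℕtoℚ (suc c)) {{ℕtoℚ-pos c}}}}

1/suc-nonNeg : ∀ c → 0ℚ ≤ 1/suc c
1/suc-nonNeg c = ℚ.nonNegative⁻¹ (1/suc c)
  {{ℚ.pos⇒nonNeg (1/suc c) {{ℚ.1/pos⇒pos (ℕtoℚ (suc c)) {{ℕtoℚ-pos c}}}}}}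

ratio-cancel : ∀ k m n c → k ℕ.* m ≡ n ℕ.* suc c → ℕtoℚ k * (1/suc c * ℕtoℚ m) ≡ ℕtoℚ n
ratio-cancel k m n c km≡nc = begin
  K * (w * M)      ≡⟨ ℚ.*-assoc K w M ⟨
  (K * w) * M      ≡⟨ cong (_* M) (ℚ.*-comm K w) ⟩
  (w * K) * M      ≡⟨ ℚ.*-assoc w K M ⟩
  w * (K * M)      ≡⟨ cong (w *_) (ℕtoℚ-* k m) ⟨
  w * ℕtoℚ (k ℕ.* m)      ≡⟨ cong (λ x → w * ℕtoℚ x) km≡nc ⟩
  w * ℕtoℚ (n ℕ.* suc c)  ≡⟨ cong (w *_) (trans (ℕtoℚ-* n (suc c)) (ℚ.*-comm (ℕtoℚ n) C)) ⟩
  w * (C * ℕtoℚ n) ≡⟨ ℚ.*-assoc w C (ℕtoℚ n) ⟨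
  (w * C) * ℕtoℚ n ≡⟨ cong (_* ℕtoℚ n) (1/suc-inverse c) ⟩
  1ℚ * ℕtoℚ n      ≡⟨ ℚ.*-identityˡ (ℕtoℚ n) ⟩
  ℕtoℚ n           ∎
  where
  open ≡-Reasoning
  K = ℕtoℚ k
  M = ℕtoℚ m
  C = ℕtoℚ (suc c)
  w = 1/suc c

regularCocoloring : ∀ {n N} (G : Graph n) (d : Fin N → Subset n) (𝓕 : Subset N) →
  (homogeneous : AllHomogeneous G d 𝓕) → ∀ c → (∀ v → ∣ 𝓕 ∩ containing d v ∣ ≡ suc c) →
  Σ (List (Entry G)) λ es → IsFractionalCocoloring G es × totalWeight G es ≡ 1/suc c * ℕtoℚ ∣ 𝓕 ∣
regularCocoloring G d 𝓕 homogeneous c regular =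
  es , covering , totalWeight-family G (1/suc c) (1/suc-nonNeg c) d 𝓕 homogeneous
  where
  es = familyEntries G (1/suc c) (1/suc-nonNeg c) d 𝓕 homogeneous
  covering : IsFractionalCocoloring G es
  covering v = ℚ.≤-reflexive (sym (begin
    coverage G v es                           ≡⟨ coverage-family G (1/suc c) (1/suc-nonNeg c) v d 𝓕 homogeneous ⟩
    1/suc c * ℕtoℚ ∣ 𝓕 ∩ containing d v ∣     ≡⟨ cong (λ s → 1/suc c * ℕtoℚ s) (regular v) ⟩
    1/suc c * ℕtoℚ (suc c)                    ≡⟨ 1/suc-inverse c ⟩
    1ℚ                                        ∎))
    where open ≡-Reasoning

degree : ∀ {n} → Subset (2 ℕ.^ n) → Fin n → ℕ
degree {n} 𝓕 v = ∣ 𝓕 ∩ containing (decode {n}) v ∣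

-- If 𝓕 is invariant under the action of g, then g maps the members containing v
-- injectively to members containing g v.
degree-≤ : ∀ {n} (g : Permutation′ n) (𝓕 : Subset (2 ℕ.^ n)) → img (lift g) 𝓕 ⊆ 𝓕 →
  ∀ v → degree 𝓕 v ℕ.≤ degree 𝓕 (g ⟨$⟩ʳ v)
degree-≤ {n} g 𝓕 invariant v = begin
  ∣ 𝓕 ∩ containing decode v ∣                   ≡⟨ ∣img∣ (lift g) (𝓕 ∩ containing decode v) ⟨
  ∣ img (lift g) (𝓕 ∩ containing decode v) ∣    ≤⟨ Subset.p⊆q⇒∣p∣≤∣q∣ moved ⟩
  ∣ 𝓕 ∩ containing decode (g ⟨$⟩ʳ v) ∣           ∎
  where
  open ℕ.≤-Reasoning
  moved : img (lift g) (𝓕 ∩ containing decode v) ⊆ 𝓕 ∩ containing decode (g ⟨$⟩ʳ v)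
  moved {i} i∈ = Subset.x∈p∩q⁺ (member , contains)
    where
    j = lift g ⟨$⟩ˡ i
    j∈ = Subset.x∈p∩q⁻ 𝓕 (containing decode v) (∈-img⁻ (lift g) i∈)
    decode-i : img g (decode {n} j) ≡ decode i
    decode-i = trans (sym (decode-lift g j)) (cong decode (inverseʳ (lift g)))
    member : i ∈ 𝓕
    member = invariant (subst (_∈ img (lift g) 𝓕) (inverseʳ (lift g)) (∈-img⁺ (lift g) (proj₁ j∈)))
    contains : i ∈ containing decode (g ⟨$⟩ʳ v)
    contains = ∈-containing⁺ {d = decode {n}}
      (subst (g ⟨$⟩ʳ v ∈_) decode-i (∈-img⁺ g (∈-containing⁻ {d = decode {n}} (proj₂ j∈))))

module OrbitConstruction {n} (G : Graph n) (transitive : VertexTransitive G) (k : ℕ) where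

  automorphism : Fin n → Fin n → Permutation′ n
  automorphism u v = proj₁ (transitive u v)

  action : Fin (n ℕ.* n) → Permutation′ (2 ℕ.^ n)
  action j = lift (uncurry automorphism (remQuot n j))

  action-combine : ∀ u v → action (combine u v) ≡ lift (automorphism u v)
  action-combine u v = cong (lift ∘ uncurry automorphism) (Fin.remQuot-combine u v)

  Member : Fin (2 ℕ.^ n) → Set
  Member i = IsHomogeneousOfSize G k (decode i)

  action-preserves : ∀ j {i} → Member i → Member (action j ⟨$⟩ʳ i)
  action-preserves j {i} member =
    subst (IsHomogeneousOfSize G k) (sym (decode-lift g i))
          (homogeneous-img G g (proj₁ (proj₂ (uncurry transitive (remQuot n j)))) member)
    where g = uncurry automorphism (remQuot n j)

  orbit : ∀ S → IsHomogeneousOfSize G k S → Closure action Member ⁅ encode S ⁆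
  orbit S homogeneous = closure action Member action-preserves ⁅ encode S ⁆ initial
    where
    initial : ∀ {i} → i ∈ ⁅ encode S ⁆ → Member i
    initial i∈ = subst Member (sym (Subset.x∈⁅y⁆⇒x≡y _ i∈))
                       (subst (IsHomogeneousOfSize G k) (sym (decode-encode S)) homogeneous)

  degree-uniform : ∀ {p} (𝓕 : Closure action Member p) → ∀ u v →
    degree (Closure.carrier 𝓕) u ≡ degree (Closure.carrier 𝓕) v
  degree-uniform 𝓕 u v = ℕ.≤-antisym (moves u v) (moves v u)
    where
    moves : ∀ u v → degree (Closure.carrier 𝓕) u ℕ.≤ degree (Closure.carrier 𝓕) v
    moves u v = subst (λ w → degree (Closure.carrier 𝓕) u ℕ.≤ degree (Closure.carrier 𝓕) w)
                      (proj₂ (proj₂ (transitive u v)))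
                      (degree-≤ (automorphism u v) (Closure.carrier 𝓕)
                                (subst (λ σ → img σ (Closure.carrier 𝓕) ⊆ Closure.carrier 𝓕)
                                       (action-combine u v) (Closure.closed 𝓕 (combine u v)))
                                u)

  optimalCocoloring : ∀ S → IsHomogeneousOfSize G k S → 1 ℕ.≤ k → Fin n →
    Σ (List (Entry G)) λ es → IsFractionalCocoloring G es × ℕtoℚ k * totalWeight G es ≡ ℕtoℚ n
  optimalCocoloring S homogeneous 1≤k v₀ = fromDegree (degree 𝓕 v₀) refl
    where
    O = orbit S homogeneous
    𝓕 = Closure.carrier O

    incidences : n ℕ.* degree 𝓕 v₀ ≡ k ℕ.* ∣ 𝓕 ∣
    incidences = begin
      n ℕ.* degree 𝓕 v₀                    ≡⟨ ∑ℕ-const n (degree 𝓕 v₀) ⟨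
      ∑ℕ.sum {n} (λ _ → degree 𝓕 v₀)       ≡⟨ ∑ℕ.sum-cong-≗ (degree-uniform O v₀) ⟩
      ∑ℕ.sum {n} (λ v → degree 𝓕 v)       ≡⟨ ∑-incidences k (decode {n}) 𝓕 (λ i∈ → proj₂ (Closure.respects O i∈)) ⟩
      k ℕ.* ∣ 𝓕 ∣                          ∎
      where open ≡-Reasoning

    -- the orbit contains S, and k ≥ 1, so the degree of v₀ is positive
    fromDegree : ∀ c → degree 𝓕 v₀ ≡ c →
      Σ (List (Entry G)) λ es → IsFractionalCocoloring G es × ℕtoℚ k * totalWeight G es ≡ ℕtoℚ n
    fromDegree zero    degree≡0 = contradiction (subst (1 ℕ.≤_) no-incidences positive) λ ()
      where
      positive : 1 ℕ.≤ k ℕ.* ∣ 𝓕 ∣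
      positive = ℕ.*-mono-≤ 1≤k (∈⇒1≤∣∣ (Closure.extends O (Subset.x∈⁅x⁆ (encode S))))
      no-incidences : k ℕ.* ∣ 𝓕 ∣ ≡ 0
      no-incidences = trans (sym incidences) (trans (cong (n ℕ.*_) degree≡0) (ℕ.*-zeroʳ n))
    fromDegree (suc c) degree≡ =
      es , covering , trans (cong (ℕtoℚ k *_) weight≡)
                            (ratio-cancel k ∣ 𝓕 ∣ n c (trans (sym incidences) (cong (n ℕ.*_) degree≡)))
      where
      regular = regularCocoloring G (decode {n}) 𝓕 (λ i∈ → proj₁ (Closure.respects O i∈)) c
                                  (λ v → trans (sym (degree-uniform O v₀ v)) degree≡)
      es = proj₁ regular
      covering = proj₁ (proj₂ regular)
      weight≡ = proj₂ (proj₂ regular)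

-- Total weights are nonnegative, which settles the graph without vertices.
totalWeight-nonNeg : ∀ {n} (G : Graph n) es → 0ℚ ≤ totalWeight G es
totalWeight-nonNeg G []       = ℚ.≤-refl
totalWeight-nonNeg G (e ∷ es) = ℚ.+-mono-≤ (nonneg e) (totalWeight-nonNeg G es)

meetsLowerBound : ∀ {n} (G : Graph n) k → 1 ℕ.≤ k →
  (∀ es → IsFractionalCocoloring G es → ℕtoℚ n ≤ ℕtoℚ k * totalWeight G es) →
  ∀ es → IsFractionalCocoloring G es → ℕtoℚ k * totalWeight G es ≡ ℕtoℚ n →
  IsFracCochromaticNumber G (totalWeight G es)
meetsLowerBound G (suc k) _ lower es covering tight = (es , covering , refl) , minimal
  where
  minimal : ∀ es′ → IsFractionalCocoloring G es′ → totalWeight G es ≤ totalWeight G es′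
  minimal es′ covering′ = ℚ.*-cancelˡ-≤-pos (ℕtoℚ (suc k)) {{ℕtoℚ-pos k}}
    (ℚ.≤-trans (ℚ.≤-reflexive tight) (lower es′ covering′))

transitiveCase : ∀ n (G : Graph n) k S → IsHomogeneousOfSize G k S → (Fin n → 1 ℕ.≤ k) →
  (∀ es → IsFractionalCocoloring G es → ℕtoℚ n ≤ ℕtoℚ k * totalWeight G es) →
  VertexTransitive G → Σ ℚ λ z → IsFracCochromaticNumber G z × ℕtoℚ k * z ≡ ℕtoℚ n
transitiveCase zero G k S homogeneous 1≤k lower transitive =
  0ℚ , (([] , (λ ()) , refl) , λ es _ → totalWeight-nonNeg G es) , ℚ.*-zeroʳ (ℕtoℚ k)
transitiveCase (suc n) G k S homogeneous 1≤k lower transitive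
  with OrbitConstruction.optimalCocoloring G transitive k S homogeneous (1≤k zero) zero
... | es , covering , tight = totalWeight G es , meetsLowerBound G k (1≤k zero) lower es covering tight , tight

1≤independenceNumber : ∀ {n} (G : Graph n) {a} → IsIndependenceNumber G a → Fin n → 1 ℕ.≤ a
1≤independenceNumber G isα x = subst (ℕ._≤ _) (Subset.∣⁅x⁆∣≡1 x) (proj₂ isα ⁅ x ⁆ singleton)
  where
  singleton : IsIndependent G ⁅ x ⁆
  singleton u v u∈ v∈ adj =
    irrefl G (subst₂ (Adj G) (Subset.x∈⁅y⁆⇒x≡y x u∈) (Subset.x∈⁅y⁆⇒x≡y x v∈) adj)

proposition1 : ∀ (n : ℕ) (G : Graph n) (a c : ℕ) →
    IsIndependenceNumber G a → IsCliqueNumber G c →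
    (∀ (es : List (Entry G)) → IsFractionalCocoloring G es →
        ℕtoℚ n ≤ ℕtoℚ (a ⊔ c) * totalWeight G es)
    × (VertexTransitive G →
        Σ ℚ λ z → IsFracCochromaticNumber G z × ℕtoℚ (a ⊔ c) * z ≡ ℕtoℚ n)
proposition1 n G a c isα isω = lower , transitiveCase n G (a ⊔ c) S homogeneous 1≤k lower
  where
  bounded : ∀ e → ∣ set e ∣ ℕ.≤ a ⊔ c
  bounded e with cliqueOrIndep e
  ... | inj₁ clique      = ℕ.≤-trans (proj₂ isω (set e) clique) (ℕ.m≤n⊔m a c)
  ... | inj₂ independent = ℕ.≤-trans (proj₂ isα (set e) independent) (ℕ.m≤m⊔n a c)
  lower = lowerBound G (a ⊔ c) bounded
  largest : Σ (Subset n) (IsHomogeneousOfSize G (a ⊔ c))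
  largest with ℕ.≤-total c a | proj₁ isα | proj₁ isω
  ... | inj₁ c≤a | S , independent , size | _ = S , inj₂ independent , trans size (sym (ℕ.m≥n⇒m⊔n≡m c≤a))
  ... | inj₂ a≤c | _ | S , clique , size      = S , inj₁ clique , trans size (sym (ℕ.m≤n⇒m⊔n≡n a≤c))
  S = proj₁ largest
  homogeneous = proj₂ largest
  1≤k : Fin n → 1 ℕ.≤ a ⊔ c
  1≤k x = ℕ.≤-trans (1≤independenceNumber G isα x) (ℕ.m≤m⊔n a c)
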